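{- Every subset $M\subseteq\{\pm e_1,\dots,\pm e_n\}\subset\mathbb R^n$ is a strong Coxeter matroid for the root system $C_n$.
   Context: The root system $C_n$ is $\{\pm e_i\pm e_j: i\neq j\}\cup\{\pm2e_i\}$ with Weyl group $W(C_n)$; $\{\pm e_1,\dots,\pm e_n\}$ is the $W(C_n)$-orbit of $-e_1$ (the cosets $W(C_n)/W(C_{n-1})$ for the maximal parabolic omitting the first simple reflection). A subset $M$ is a strong Coxeter matroid if for any distinct $p,q\in M$ there is a root $\alpha$ whose hyperplane $\alpha^\perp$ separates $p$ and $q$ with $s_\alpha p,s_\alpha q\in M$, where $s_\alpha$ is the reflection in $\alpha^\perp$. -}

module Defs where

open import Data.Nat using (ℕ; zero; suc)
open import Data.Fin using (Fin; zero; suc; _≟_)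
open import Data.Integer using (ℤ; +_; -_; _+_; _-_; _*_; _<_; 0ℤ; 1ℤ)
open import Data.Product using (Σ; ∃; _×_; _,_)
open import Data.Sum using (_⊎_)
open import Relation.Nullary using (¬_; yes; no)
open import Relation.Binary.PropositionalEquality using (_≡_; _≢_)
open import Relation.Unary using (Pred)
open import Level using (0ℓ)

-- Vectors of ℝⁿ with integer coordinates (all roots of Cₙ, the points ±eᵢ and
-- their images under reflections in roots of Cₙ lie in ℤⁿ).
Vec : ℕ → Set
Vec n = Fin n → ℤ

_≈_ : ∀ {n} → Vec n → Vec n → Set
u ≈ v = ∀ k → u k ≡ v k

_·_ : ∀ {n} → Vec n → Vec n → ℤ
_·_ {zero}  u v = 0ℤ
_·_ {suc n} u v = u zero * v zero + ((λ k → u (suc k)) · (λ k → v (suc k)))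

e : ∀ {n} → Fin n → Vec n
e i k with i ≟ k
... | yes _ = 1ℤ
... | no  _ = 0ℤ

data Sign : Set where
  plus minus : Sign

sgn : Sign → ℤ
sgn plus  = 1ℤ
sgn minus = - 1ℤ

IsRootC : ∀ {n} → Vec n → Set
IsRootC {n} α =
    (Σ (Fin n) λ i → Σ (Fin n) λ j → i ≢ j × Σ Sign λ s → Σ Sign λ t →
       α ≈ (λ k → sgn s * e i k + sgn t * e j k))
  ⊎ (Σ (Fin n) λ i → Σ Sign λ s → α ≈ (λ k → sgn s * (+ 2) * e i k))

-- w is the reflection s_α v of v in the hyperplane α^⊥, i.e.
--   w = v - (2 (v·α) / (α·α)) α,
-- written multiplied through by α·α (which is nonzero for a root, so this
-- determines w uniquely).
IsReflection : ∀ {n} → Vec n → Vec n → Vec n → Set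
IsReflection α v w = ∀ k → (α · α) * w k ≡ (α · α) * v k - (+ 2) * (v · α) * α k

Separates : ∀ {n} → Vec n → Vec n → Vec n → Set
Separates α p q = ((0ℤ < p · α) × (q · α < 0ℤ)) ⊎ ((p · α < 0ℤ) × (0ℤ < q · α))

Point : ℕ → Set
Point n = Sign × Fin n

vec : ∀ {n} → Point n → Vec n
vec (s , i) k = sgn s * e i k

StrongCoxeterMatroidC : (n : ℕ) → Pred (Point n) 0ℓ → Set
StrongCoxeterMatroidC n M =
  ∀ (p q : Point n) → M p → M q → p ≢ q →
    Σ (Vec n) λ α → IsRootC α × Separates α (vec p) (vec q)
      × (Σ (Point n) λ p′ → M p′ × IsReflection α (vec p) (vec p′))
      × (Σ (Point n) λ q′ → M q′ × IsReflection α (vec q) (vec q′))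

-- The reflection in the difference u − v of two vectors of equal length swaps them, and its
-- hyperplane separates them when u·v < u·u. Two distinct points p ≠ q of the orbit have
-- length 1 and p·q ∈ {0, −1}, and p − q is ±eᵢ ± eⱼ or ±2eᵢ, a root of Cₙ. So α = p − q
-- works with p′ = q and q′ = p, whatever M is.
module Submission where

open import Defs
open import Data.Nat using (ℕ; zero; suc; s≤s; z≤n)
open import Data.Fin using (Fin; zero; suc; _≟_)
open import Data.Integer using (ℤ; +_; -_; _+_; _-_; _*_; _<_; 0ℤ; 1ℤ; +<+; -<+)
open import Data.Integer.Properties
  using (*-comm; *-zeroʳ; *-identityˡ; +-identityˡ; +-identityʳ; neg-distribˡ-*; +-inverseʳ; +-monoˡ-<; neg-mono-<)
open import Data.Integer.Tactic.RingSolver using (solve-∀)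
open import Data.Product using (_,_)
open import Data.Sum using (inj₁; inj₂)
open import Data.Empty using (⊥-elim)
open import Relation.Nullary using (Dec; yes; no)
open import Relation.Unary using (Pred)
open import Relation.Binary.PropositionalEquality
open import Level using (0ℓ)

e-diagonal : ∀ {n} (i : Fin n) → e i i ≡ 1ℤ
e-diagonal i with i ≟ i
... | yes _   = refl
... | no  i≢i = ⊥-elim (i≢i refl)

e-offDiagonal : ∀ {n} {i k : Fin n} → i ≢ k → e i k ≡ 0ℤ
e-offDiagonal {i = i} {k} i≢k with i ≟ k
... | yes i≡k = ⊥-elim (i≢k i≡k)
... | no  _   = refl

e-suc : ∀ {n} (i k : Fin n) → e (suc i) (suc k) ≡ e i k
e-suc i k = by-cases (i ≟ k)
  where
  by-cases : Dec (i ≡ k) → e (suc i) (suc k) ≡ e i k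
  by-cases (yes refl) = trans (e-diagonal (suc i)) (sym (e-diagonal i))
  by-cases (no i≢k)   = trans (e-offDiagonal (λ { refl → i≢k refl })) (sym (e-offDiagonal i≢k))

infixl 6 _-ᵥ_
_-ᵥ_ : ∀ {n} → Vec n → Vec n → Vec n
(u -ᵥ v) k = u k - v k

·-congˡ : ∀ {n} {u u′ : Vec n} (v : Vec n) → u ≈ u′ → u · v ≡ u′ · v
·-congˡ {zero}  v u≈u′ = refl
·-congˡ {suc n} v u≈u′ =
  cong₂ _+_ (cong (_* v zero) (u≈u′ zero)) (·-congˡ (λ k → v (suc k)) (λ k → u≈u′ (suc k)))

·-comm : ∀ {n} (u v : Vec n) → u · v ≡ v · u
·-comm {zero}  u v = refl
·-comm {suc n} u v =
  cong₂ _+_ (*-comm (u zero) (v zero)) (·-comm (λ k → u (suc k)) (λ k → v (suc k)))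

·-zeroˡ : ∀ {n} (v : Vec n) → (λ _ → 0ℤ) · v ≡ 0ℤ
·-zeroˡ {zero}  v = refl
·-zeroˡ {suc n} v = trans (+-identityˡ _) (·-zeroˡ (λ k → v (suc k)))

·-distribʳ-- : ∀ {n} (u v w : Vec n) → (u -ᵥ v) · w ≡ u · w - v · w
·-distribʳ-- {zero}  u v w = refl
·-distribʳ-- {suc n} u v w
  rewrite ·-distribʳ-- (λ k → u (suc k)) (λ k → v (suc k)) (λ k → w (suc k)) =
  distrib (u zero) (v zero) (w zero) _ _
  where
  distrib : ∀ a b c x y → (a - b) * c + (x - y) ≡ (a * c + x) - (b * c + y)
  distrib = solve-∀

·-distribˡ-- : ∀ {n} (w u v : Vec n) → w · (u -ᵥ v) ≡ w · u - w · v
·-distribˡ-- w u v = begin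
  w · (u -ᵥ v)    ≡⟨ ·-comm w (u -ᵥ v) ⟩
  (u -ᵥ v) · w    ≡⟨ ·-distribʳ-- u v w ⟩
  u · w - v · w   ≡⟨ cong₂ _-_ (·-comm u w) (·-comm v w) ⟩
  w · u - w · v   ∎
  where open ≡-Reasoning

·-scaleˡ : ∀ {n} (c : ℤ) (u v : Vec n) → (λ k → c * u k) · v ≡ c * (u · v)
·-scaleˡ {zero}  c u v = sym (*-zeroʳ c)
·-scaleˡ {suc n} c u v =
  trans (cong (_+_ (c * u zero * v zero)) (·-scaleˡ c (λ k → u (suc k)) (λ k → v (suc k))))
        (distrib c (u zero) (v zero) _)
  where
  distrib : ∀ c x y z → c * x * y + c * z ≡ c * (x * y + z)
  distrib = solve-∀

e-·ˡ : ∀ {n} (i : Fin n) (v : Vec n) → e i · v ≡ v i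
e-·ˡ zero v
  rewrite ·-zeroˡ (λ k → v (suc k)) | *-identityˡ (v zero) = +-identityʳ (v zero)
e-·ˡ (suc i) v
  rewrite ·-congˡ (λ k → v (suc k)) (e-suc i) | e-·ˡ i (λ k → v (suc k)) = +-identityˡ (v (suc i))

<⇒0<- : ∀ {x y} → x < y → 0ℤ < y - x
<⇒0<- {x} {y} x<y = subst (_< y - x) (+-inverseʳ x) (+-monoˡ-< (- x) x<y)

module EqualLength {n} {u v : Vec n} (u·u≡v·v : u · u ≡ v · v) where

  private
    α : Vec n
    α = u -ᵥ v

  v·α≡-u·α : v · α ≡ - (u · α)
  v·α≡-u·α = begin
    v · α              ≡⟨ ·-distribˡ-- v u v ⟩
    v · u - v · v      ≡⟨ cong₂ _-_ (·-comm v u) (sym u·u≡v·v) ⟩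
    u · v - u · u      ≡⟨ antisym (u · u) (u · v) ⟩
    - (u · u - u · v)  ≡⟨ cong -_ (sym (·-distribˡ-- u u v)) ⟩
    - (u · α)          ∎
    where
    open ≡-Reasoning
    antisym : ∀ x y → y - x ≡ - (x - y)
    antisym = solve-∀

  α·α≡2u·α : α · α ≡ + 2 * (u · α)
  α·α≡2u·α = begin
    α · α              ≡⟨ ·-distribʳ-- u v α ⟩
    u · α - v · α      ≡⟨ cong (_-_ (u · α)) v·α≡-u·α ⟩
    u · α - - (u · α)  ≡⟨ double (u · α) ⟩
    + 2 * (u · α)      ∎
    where
    open ≡-Reasoning
    double : ∀ x → x - - x ≡ + 2 * x
    double = solve-∀

  reflection-u↦v : IsReflection α u v
  reflection-u↦v k rewrite α·α≡2u·α = swap (u · α) (u k) (v k)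
    where
    swap : ∀ c x y → + 2 * c * y ≡ + 2 * c * x - + 2 * c * (x - y)
    swap = solve-∀

  reflection-v↦u : IsReflection α v u
  reflection-v↦u k rewrite α·α≡2u·α | v·α≡-u·α = swap (u · α) (u k) (v k)
    where
    swap : ∀ c x y → + 2 * c * x ≡ + 2 * c * y - + 2 * - c * (x - y)
    swap = solve-∀

  separates : u · v < u · u → Separates α u v
  separates u·v<u·u = inj₁ (0<u·α , v·α<0)
    where
    0<u·α : 0ℤ < u · α
    0<u·α = subst (0ℤ <_) (sym (·-distribˡ-- u u v)) (<⇒0<- u·v<u·u)
    v·α<0 : v · α < 0ℤ
    v·α<0 = subst (_< 0ℤ) (sym v·α≡-u·α) (neg-mono-< 0<u·α)

opposite : Sign → Sign
opposite plus  = minus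
opposite minus = plus

sgn-opposite : ∀ s → sgn (opposite s) ≡ - sgn s
sgn-opposite plus  = refl
sgn-opposite minus = refl

data Distinct {n} : Point n → Point n → Set where
  different-axes : ∀ {s t i j} → i ≢ j → Distinct (s , i) (t , j)
  antipodal      : ∀ {s i} → Distinct (s , i) (opposite s , i)

≢⇒distinct : ∀ {n} {p q : Point n} → p ≢ q → Distinct p q
≢⇒distinct {p = s , i} {t , j} p≢q with i ≟ j
... | no i≢j = different-axes i≢j
≢⇒distinct {p = plus  , i} {plus  , .i} p≢q | yes refl = ⊥-elim (p≢q refl)
≢⇒distinct {p = plus  , i} {minus , .i} p≢q | yes refl = antipodal
≢⇒distinct {p = minus , i} {plus  , .i} p≢q | yes refl = antipodal
≢⇒distinct {p = minus , i} {minus , .i} p≢q | yes refl = ⊥-elim (p≢q refl)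

vec-·ˡ : ∀ {n} (s : Sign) (i : Fin n) (w : Vec n) → vec (s , i) · w ≡ sgn s * w i
vec-·ˡ s i w = trans (·-scaleˡ (sgn s) (e i) w) (cong (sgn s *_) (e-·ˡ i w))

vec-·-vec-self : ∀ {n} (p : Point n) → vec p · vec p ≡ 1ℤ
vec-·-vec-self (s , i) rewrite vec-·ˡ s i (vec (s , i)) | e-diagonal i with s
... | plus  = refl
... | minus = refl

vec-·-vec<1 : ∀ {n} {p q : Point n} → Distinct p q → vec p · vec q < 1ℤ
vec-·-vec<1 {p = s , i} {t , j} (different-axes i≢j)
  rewrite vec-·ˡ s i (vec (t , j)) | e-offDiagonal (≢-sym i≢j)
        | *-zeroʳ (sgn t) | *-zeroʳ (sgn s) = +<+ (s≤s z≤n)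
vec-·-vec<1 {p = s , i} antipodal rewrite vec-·ˡ s i (vec (opposite s , i)) | e-diagonal i with s
... | plus  = -<+
... | minus = -<+

vec-difference-isRoot : ∀ {n} {p q : Point n} → Distinct p q → IsRootC (vec p -ᵥ vec q)
vec-difference-isRoot {p = s , i} {t , j} (different-axes i≢j) =
  inj₁ (i , j , i≢j , s , opposite t , λ k →
    cong (_+_ (sgn s * e i k))
         (trans (neg-distribˡ-* (sgn t) (e j k)) (cong (_* e j k) (sym (sgn-opposite t)))))
vec-difference-isRoot {p = s , i} antipodal =
  inj₂ (i , s , λ k → trans (cong (λ c → sgn s * e i k - c * e i k) (sgn-opposite s)) (double (sgn s) (e i k)))
  where
  double : ∀ a x → a * x - - a * x ≡ a * + 2 * x
  double = solve-∀

lemma3p12 : (n : ℕ) (M : Pred (Point n) 0ℓ) → StrongCoxeterMatroidC n M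
lemma3p12 n M p q Mp Mq p≢q =
  vec p -ᵥ vec q , vec-difference-isRoot distinct ,
  separates (subst (vec p · vec q <_) (sym (vec-·-vec-self p)) (vec-·-vec<1 distinct)) ,
  (q , Mq , reflection-u↦v) , (p , Mp , reflection-v↦u)
  where
  distinct : Distinct p q
  distinct = ≢⇒distinct p≢q
  open EqualLength {u = vec p} {v = vec q} (trans (vec-·-vec-self p) (sym (vec-·-vec-self q)))
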